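{- Let $\Delta$ be a labeled hypergraph on $[d]$ (with respect to a fixed integer $n$) such that for all $0\le i,j\le n-1$ and all $e_1\in\Delta_i$, $e_2\in\Delta_j$, $$i+j\ \ge\ v_\Delta(e_1\cap e_2)+v_\Delta(e_1\cup e_2).$$ Then the collection $$\mathcal{C}=\min\Big(\bigcup_{0\le i\le n-1}\ \bigcup_{e\in\Delta_i}\binom{e}{i+1}\ \cup\ \binom{[d]}{n+1}\Big)$$ of inclusion-minimal sets is the set of circuits of a matroid $M_\Delta$ on $[d]$.
   Context: A labeled hypergraph $\Delta$ on $[d]$ is a collection of subsets (edges) each labeled with a Type $i\in\{0,\dots,n-1\}$, such that no two edges of the same type are properly contained in one another and each edge of Type $i$ has at least $i+1$ elements; $\Delta_i$ is the set of edges of Type $i$. $\binom{S}{k}$ denotes the set of $k$-subsets of $S$. The valuation $v_\Delta:2^{[d]}\to\mathbb{Z}$ is $v_\Delta(A)=\min\{|A|,\ n,\ |A\setminus e|+i : 0\le i\le n-1,\ e\in\Delta_i\}$. -}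

module Defs where

open import Data.Nat using (ℕ; suc; _+_; _≤_; _⊓_)
open import Data.Fin using (Fin; toℕ)
open import Data.Fin.Subset using (Subset; _∈_; _⊆_; _⊂_; _∩_; _∪_; _─_; _-_; ∣_∣; ⊥; ⊤)
open import Data.List using (List; foldr)
open import Data.List.Membership.Propositional using () renaming (_∈_ to _∈ₗ_)
open import Data.Product using (Σ; _×_; _,_; ∃)
open import Data.Sum using (_⊎_)
open import Relation.Binary.PropositionalEquality using (_≡_; _≢_)
open import Relation.Nullary using (¬_)

-- A labeled hypergraph on [d] = Fin d with types in {0,…,n-1} = Fin n:
-- a (finite) collection of labeled edges (i , e), e ⊆ [d] of Type i.
-- Δ_i = { e ∣ (i , e) ∈ Δ }.
LabeledEdges : ℕ → ℕ → Set
LabeledEdges n d = List (Fin n × Subset d)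

record IsLabeledHypergraph (n d : ℕ) (Δ : LabeledEdges n d) : Set where
  field
    antichain : ∀ (i : Fin n) (e f : Subset d) →
                (i , e) ∈ₗ Δ → (i , f) ∈ₗ Δ → ¬ (e ⊂ f)
    size      : ∀ (i : Fin n) (e : Subset d) → (i , e) ∈ₗ Δ → suc (toℕ i) ≤ ∣ e ∣

valuation : ∀ {n d} → LabeledEdges n d → Subset d → ℕ
valuation {n} Δ A = foldr step (∣ A ∣ ⊓ n) Δ
  where
  step : _ → ℕ → ℕ
  step (i , e) acc = acc ⊓ (∣ A ─ e ∣ + toℕ i)

InGenerators : ∀ {n d} → LabeledEdges n d → Subset d → Set
InGenerators {n} {d} Δ S =
  (Σ (Fin n) λ i → Σ (Subset d) λ e → (i , e) ∈ₗ Δ × S ⊆ e × ∣ S ∣ ≡ suc (toℕ i))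
  ⊎ (∣ S ∣ ≡ suc n)

InMinGenerators : ∀ {n d} → LabeledEdges n d → Subset d → Set
InMinGenerators Δ S = InGenerators Δ S × (∀ T → InGenerators Δ T → ¬ (T ⊂ S))

record IsMatroidCircuits (d : ℕ) (𝒞 : Subset d → Set) : Set where
  field
    C1 : ¬ 𝒞 ⊥
    C2 : ∀ X Y → 𝒞 X → 𝒞 Y → X ⊆ Y → X ≡ Y
    C3 : ∀ X Y (x : Fin d) → 𝒞 X → 𝒞 Y → X ≢ Y → x ∈ X ∩ Y →
         ∃ λ Z → 𝒞 Z × Z ⊆ (X ∪ Y) - x

{-# OPTIONS --safe #-}
-- Call A ⊆ [d] dependent when v_Δ(A) < |A|. Every generator is dependent, and every
-- dependent set contains a generator, so the inclusion-minimal generators are exactly the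
-- inclusion-minimal dependent sets. Circuit elimination then reduces to showing that
-- (X ∪ Y) - x is dependent for distinct circuits X, Y. As X ∩ Y is a proper subset of X,
-- it is independent: |X ∩ Y| ≤ v(X ∩ Y). If X ⊆ e₁ ∈ Δ_i and Y ⊆ e₂ ∈ Δ_j have sizes
-- i + 1 and j + 1, monotonicity of v and the hypothesis give
--   v((X ∪ Y) - x) + |X ∩ Y| ≤ v(e₁ ∪ e₂) + v(e₁ ∩ e₂) ≤ i + j < |(X ∪ Y) - x| + |X ∩ Y|;
-- if instead |X| = n + 1, then |(X ∪ Y) - x| ≥ |X| > n ≥ v((X ∪ Y) - x).
module Submission where

open import Defs
open import Data.Fin using (Fin; toℕ; zero; suc)
open import Data.Fin.Subset
  using (Subset; inside; outside; _⊆_; _⊂_; _∩_; _∪_; _─_; _-_; ⁅_⁆; ∣_∣; ⊥; Empty)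
  renaming (_∈_ to _∈ₛ_; _∉_ to _∉ₛ_)
open import Data.Fin.Subset.Properties
open import Data.List using ([]; _∷_)
open import Data.List.Membership.Propositional using (_∈_; find)
open import Data.List.Relation.Unary.Any as Any using (Any)
open import Data.Nat using (ℕ; zero; suc; _+_; _≤_; _<_; _⊓_; _<?_; s≤s⁻¹)
open import Data.Nat.Induction using (<-wellFounded)
open import Data.Nat.Properties
open import Data.Product using (∃; _×_; _,_; proj₁)
open import Data.Sum as Sum using (_⊎_; inj₁; inj₂)
open import Data.Vec using ([]; _∷_; there)
open import Function using (_∘_)
open import Induction.WellFounded using (Acc; acc)
open import Level using (Level; 0ℓ)
open import Relation.Binary.PropositionalEquality
  using (_≡_; _≢_; refl; sym; trans; cong; cong₂; subst; module ≡-Reasoning)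
open import Relation.Nullary using (¬_; yes; no; contradiction)
open import Relation.Nullary.Decidable using (decidable-stable; _×-dec_)
open import Relation.Unary using (Pred; Decidable)

private
  variable
    ℓ : Level
    m : ℕ
    p q : Subset m

∣p∣≡∣p∩q∣+∣p─q∣ : ∀ (p q : Subset m) → ∣ p ∣ ≡ ∣ p ∩ q ∣ + ∣ p ─ q ∣
∣p∣≡∣p∩q∣+∣p─q∣ []            []            = refl
∣p∣≡∣p∩q∣+∣p─q∣ (inside  ∷ p) (inside  ∷ q) = cong suc (∣p∣≡∣p∩q∣+∣p─q∣ p q)
∣p∣≡∣p∩q∣+∣p─q∣ (inside  ∷ p) (outside ∷ q) =
  trans (cong suc (∣p∣≡∣p∩q∣+∣p─q∣ p q)) (sym (+-suc _ _))
∣p∣≡∣p∩q∣+∣p─q∣ (outside ∷ p) (inside  ∷ q) = ∣p∣≡∣p∩q∣+∣p─q∣ p q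
∣p∣≡∣p∩q∣+∣p─q∣ (outside ∷ p) (outside ∷ q) = ∣p∣≡∣p∩q∣+∣p─q∣ p q

∣p∪q∣+∣p∩q∣≡∣p∣+∣q∣ : ∀ (p q : Subset m) → ∣ p ∪ q ∣ + ∣ p ∩ q ∣ ≡ ∣ p ∣ + ∣ q ∣
∣p∪q∣+∣p∩q∣≡∣p∣+∣q∣ []            []            = refl
∣p∪q∣+∣p∩q∣≡∣p∣+∣q∣ (inside  ∷ p) (inside  ∷ q) = cong suc (begin
  ∣ p ∪ q ∣ + suc ∣ p ∩ q ∣   ≡⟨ +-suc _ _ ⟩
  suc (∣ p ∪ q ∣ + ∣ p ∩ q ∣) ≡⟨ cong suc (∣p∪q∣+∣p∩q∣≡∣p∣+∣q∣ p q) ⟩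
  suc (∣ p ∣ + ∣ q ∣)         ≡⟨ +-suc _ _ ⟨
  ∣ p ∣ + suc ∣ q ∣           ∎)
  where open ≡-Reasoning
∣p∪q∣+∣p∩q∣≡∣p∣+∣q∣ (inside  ∷ p) (outside ∷ q) = cong suc (∣p∪q∣+∣p∩q∣≡∣p∣+∣q∣ p q)
∣p∪q∣+∣p∩q∣≡∣p∣+∣q∣ (outside ∷ p) (inside  ∷ q) =
  trans (cong suc (∣p∪q∣+∣p∩q∣≡∣p∣+∣q∣ p q)) (sym (+-suc _ _))
∣p∪q∣+∣p∩q∣≡∣p∣+∣q∣ (outside ∷ p) (outside ∷ q) = ∣p∪q∣+∣p∩q∣≡∣p∣+∣q∣ p q

∣p∣≤1+∣p-x∣ : ∀ (p : Subset m) x → ∣ p ∣ ≤ suc ∣ p - x ∣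
∣p∣≤1+∣p-x∣ p x = begin
  ∣ p ∣                     ≡⟨ ∣p∣≡∣p∩q∣+∣p─q∣ p ⁅ x ⁆ ⟩
  ∣ p ∩ ⁅ x ⁆ ∣ + ∣ p - x ∣ ≤⟨ +-monoˡ-≤ ∣ p - x ∣ (∣p∩q∣≤∣q∣ p ⁅ x ⁆) ⟩
  ∣ ⁅ x ⁆ ∣ + ∣ p - x ∣     ≡⟨ cong (_+ ∣ p - x ∣) (∣⁅x⁆∣≡1 x) ⟩
  suc ∣ p - x ∣             ∎
  where open ≤-Reasoning

x∈p─q⇒x∉q : ∀ {p q : Subset m} {x} → x ∈ₛ p ─ q → x ∉ₛ q
x∈p─q⇒x∉q {p = _ ∷ _} {inside  ∷ _} {zero}  ()
x∈p─q⇒x∉q {p = _ ∷ _} {outside ∷ _} {zero}  _             ()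
x∈p─q⇒x∉q {p = _ ∷ _} {_       ∷ _} {suc _} (there x∈p─q) (there x∈q) =
  x∈p─q⇒x∉q x∈p─q x∈q

p⊆q⇒∣p─q∣≡0 : p ⊆ q → ∣ p ─ q ∣ ≡ 0
p⊆q⇒∣p─q∣≡0 {m} {p} {q} p⊆q = begin
  ∣ p ─ q ∣ ≡⟨ cong ∣_∣ (Empty-unique p─q-empty) ⟩
  ∣ ⊥ {m} ∣ ≡⟨ ∣⊥∣≡0 m ⟩
  0         ∎
  where
  open ≡-Reasoning
  p─q-empty : Empty (p ─ q)
  p─q-empty (_ , x∈p─q) = x∈p─q⇒x∉q x∈p─q (p⊆q (p─q⊆p p q x∈p─q))

─-monoˡ-⊆ : ∀ r → p ⊆ q → p ─ r ⊆ q ─ r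
─-monoˡ-⊆ {p = p} r p⊆q x∈p─r = x∈p∧x∉q⇒x∈p─q (p⊆q (p─q⊆p p r x∈p─r)) (x∈p─q⇒x∉q x∈p─r)

∩-mono-⊆ : ∀ {p′ q′ : Subset m} → p ⊆ p′ → q ⊆ q′ → p ∩ q ⊆ p′ ∩ q′
∩-mono-⊆ {p = p} {q = q} p⊆p′ q⊆q′ x∈p∩q =
  let x∈p , x∈q = x∈p∩q⁻ p q x∈p∩q in x∈p∩q⁺ (p⊆p′ x∈p , q⊆q′ x∈q)

∪-mono-⊆ : ∀ {p′ q′ : Subset m} → p ⊆ p′ → q ⊆ q′ → p ∪ q ⊆ p′ ∪ q′
∪-mono-⊆ {p = p} {q = q} p⊆p′ q⊆q′ x∈p∪q =
  x∈p∪q⁺ (Sum.map p⊆p′ q⊆q′ (x∈p∪q⁻ p q x∈p∪q))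

⊆∧⊉⇒⊂ : p ⊆ q → ¬ q ⊆ p → p ⊂ q
⊆∧⊉⇒⊂ {p = p} {q = q} p⊆q q⊈p = decidable-stable (p ⊂? q) λ p⊄q →
  q⊈p λ {x} x∈q → decidable-stable (x ∈? p) λ x∉p → p⊄q (p⊆q , x , x∈q , x∉p)

p⊈q⇒p∩q⊂p : ¬ p ⊆ q → p ∩ q ⊂ p
p⊈q⇒p∩q⊂p {p = p} {q = q} p⊈q =
  ⊆∧⊉⇒⊂ (p∩q⊆p p q) λ p⊆p∩q → p⊈q (⊆-trans p⊆p∩q (p∩q⊆q p q))

q⊈p⇒p⊂p∪q : ¬ q ⊆ p → p ⊂ p ∪ q
q⊈p⇒p⊂p∪q {q = q} {p = p} q⊈p =
  ⊆∧⊉⇒⊂ (p⊆p∪q q) λ p∪q⊆p → q⊈p (⊆-trans (q⊆p∪q p q) p∪q⊆p)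

subset-of-size : ∀ (p : Subset m) k → k ≤ ∣ p ∣ → ∃ λ q → q ⊆ p × ∣ q ∣ ≡ k
subset-of-size {m} p zero _ = ⊥ , ⊆-min p , ∣⊥∣≡0 m
subset-of-size (inside ∷ p) (suc k) 1+k≤∣p∣ =
  let q , q⊆p , ∣q∣≡k = subset-of-size p k (s≤s⁻¹ 1+k≤∣p∣)
  in inside ∷ q , s⊆s q⊆p , cong suc ∣q∣≡k
subset-of-size (outside ∷ p) (suc k) 1+k≤∣p∣ =
  let q , q⊆p , ∣q∣≡k = subset-of-size p (suc k) 1+k≤∣p∣
  in outside ∷ q , s⊆s q⊆p , ∣q∣≡k

Minimal : Pred (Subset m) ℓ → Pred (Subset m) ℓ
Minimal P p = P p × (∀ q → P q → ¬ q ⊂ p)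

Minimal-⊆⇒≡ : {P : Pred (Subset m) ℓ} → Minimal P p → Minimal P q → p ⊆ q → p ≡ q
Minimal-⊆⇒≡ {p = p} {q = q} (Pp , _) (_ , q-min) p⊆q =
  ⊆-antisym p⊆q (decidable-stable (q ⊆? p) λ q⊈p → q-min p Pp (⊆∧⊉⇒⊂ p⊆q q⊈p))

⊆-minimal : {P : Pred (Subset m) ℓ} → Decidable P → P p → ∃ λ q → q ⊆ p × Minimal P q
⊆-minimal {p = p} {P = P} P? = go p (<-wellFounded ∣ p ∣)
  where
  go : ∀ p → Acc _<_ ∣ p ∣ → P p → ∃ λ q → q ⊆ p × Minimal P q
  go p (acc smaller) Pp with anySubset? (λ q → (q ⊂? p) ×-dec P? q)
  ... | no ∄q = p , ⊆-refl , Pp , λ q Pq q⊂p → ∄q (q , q⊂p , Pq)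
  ... | yes (q , q⊂p , Pq) =
    let r , r⊆q , r-min = go q (smaller (p⊂q⇒∣p∣<∣q∣ q⊂p)) Pq
    in r , ⊆-trans r⊆q (p⊂q⇒p⊆q q⊂p) , r-min

m⊓n<o⇒m<o⊎n<o : ∀ m n {o} → m ⊓ n < o → m < o ⊎ n < o
m⊓n<o⇒m<o⊎n<o m n m⊓n<o with ⊓-sel m n
... | inj₁ m⊓n≡m = inj₁ (subst (_< _) m⊓n≡m m⊓n<o)
... | inj₂ m⊓n≡n = inj₂ (subst (_< _) m⊓n≡n m⊓n<o)

module _ {n d : ℕ} where

  valuation≤n : ∀ (Δ : LabeledEdges n d) A → valuation Δ A ≤ n
  valuation≤n []            A = m⊓n≤n ∣ A ∣ n
  valuation≤n ((i , e) ∷ Δ) A = ≤-trans (m⊓n≤m _ _) (valuation≤n Δ A)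

  valuation≤∣─edge∣+type : ∀ {Δ : LabeledEdges n d} {i e} A →
                           (i , e) ∈ Δ → valuation Δ A ≤ ∣ A ─ e ∣ + toℕ i
  valuation≤∣─edge∣+type A (Any.here refl)  = m⊓n≤n _ _
  valuation≤∣─edge∣+type A (Any.there i∈Δ) =
    ≤-trans (m⊓n≤m _ _) (valuation≤∣─edge∣+type A i∈Δ)

  valuation-mono-⊆ : ∀ (Δ : LabeledEdges n d) {A B} → A ⊆ B → valuation Δ A ≤ valuation Δ B
  valuation-mono-⊆ []            A⊆B = ⊓-monoˡ-≤ n (p⊆q⇒∣p∣≤∣q∣ A⊆B)
  valuation-mono-⊆ ((i , e) ∷ Δ) A⊆B =
    ⊓-mono-≤ (valuation-mono-⊆ Δ A⊆B) (+-monoˡ-≤ (toℕ i) (p⊆q⇒∣p∣≤∣q∣ (─-monoˡ-⊆ e A⊆B)))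

  valuation<∣A∣⇒n<∣A∣⊎edge : ∀ (Δ : LabeledEdges n d) A → valuation Δ A < ∣ A ∣ →
                              n < ∣ A ∣ ⊎ Any (λ (i , e) → ∣ A ─ e ∣ + toℕ i < ∣ A ∣) Δ
  valuation<∣A∣⇒n<∣A∣⊎edge [] A v<∣A∣ with m⊓n<o⇒m<o⊎n<o ∣ A ∣ n v<∣A∣
  ... | inj₁ ∣A∣<∣A∣ = contradiction ∣A∣<∣A∣ (<-irrefl refl)
  ... | inj₂ n<∣A∣   = inj₁ n<∣A∣
  valuation<∣A∣⇒n<∣A∣⊎edge (_ ∷ Δ) A v<∣A∣ with m⊓n<o⇒m<o⊎n<o _ _ v<∣A∣
  ... | inj₁ v<∣A∣ = Sum.map₂ Any.there (valuation<∣A∣⇒n<∣A∣⊎edge Δ A v<∣A∣)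
  ... | inj₂ edge  = inj₂ (Any.here edge)

module _ {n d : ℕ} (Δ : LabeledEdges n d) where

  Dependent : Pred (Subset d) 0ℓ
  Dependent A = valuation Δ A < ∣ A ∣

  dependent? : Decidable Dependent
  dependent? A = valuation Δ A <? ∣ A ∣

  -- Definitionally equal to InMinGenerators Δ.
  Circuit : Pred (Subset d) 0ℓ
  Circuit = Minimal (InGenerators Δ)

  CrossingInequality : Set
  CrossingInequality = ∀ (i j : Fin n) (e₁ e₂ : Subset d) → (i , e₁) ∈ Δ → (j , e₂) ∈ Δ →
    valuation Δ (e₁ ∩ e₂) + valuation Δ (e₁ ∪ e₂) ≤ toℕ i + toℕ j

  ⊥-independent : ¬ Dependent ⊥
  ⊥-independent v<∣⊥∣ = n≮0 (subst (valuation Δ ⊥ <_) (∣⊥∣≡0 d) v<∣⊥∣)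

  n<∣A∣⇒dependent : ∀ A → n < ∣ A ∣ → Dependent A
  n<∣A∣⇒dependent A = ≤-<-trans (valuation≤n Δ A)

  generator⇒dependent : ∀ {S} → InGenerators Δ S → Dependent S
  generator⇒dependent {S} (inj₁ (i , e , i∈Δ , S⊆e , ∣S∣≡1+i)) = begin-strict
    valuation Δ S     ≤⟨ valuation≤∣─edge∣+type S i∈Δ ⟩
    ∣ S ─ e ∣ + toℕ i ≡⟨ cong (_+ toℕ i) (p⊆q⇒∣p─q∣≡0 S⊆e) ⟩
    toℕ i             <⟨ n<1+n (toℕ i) ⟩
    suc (toℕ i)       ≡⟨ ∣S∣≡1+i ⟨
    ∣ S ∣             ∎
    where open ≤-Reasoning
  generator⇒dependent {S} (inj₂ ∣S∣≡1+n) = n<∣A∣⇒dependent S (≤-reflexive (sym ∣S∣≡1+n))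

  dependent⇒⊇generator : ∀ {A} → Dependent A → ∃ λ S → InGenerators Δ S × S ⊆ A
  dependent⇒⊇generator {A} dep with valuation<∣A∣⇒n<∣A∣⊎edge Δ A dep
  ... | inj₁ n<∣A∣ =
    let S , S⊆A , ∣S∣≡1+n = subset-of-size A (suc n) n<∣A∣
    in S , inj₂ ∣S∣≡1+n , S⊆A
  ... | inj₂ edge with find edge
  ...   | (i , e) , i∈Δ , ∣A─e∣+i<∣A∣ =
    let S , S⊆A∩e , ∣S∣≡1+i = subset-of-size (A ∩ e) (suc (toℕ i)) i<∣A∩e∣
    in S , inj₁ (i , e , i∈Δ , ⊆-trans S⊆A∩e (p∩q⊆q A e) , ∣S∣≡1+i)
         , ⊆-trans S⊆A∩e (p∩q⊆p A e)
    where
    i<∣A∩e∣ : toℕ i < ∣ A ∩ e ∣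
    i<∣A∩e∣ = +-cancelˡ-< ∣ A ─ e ∣ _ _ (begin-strict
      ∣ A ─ e ∣ + toℕ i     <⟨ ∣A─e∣+i<∣A∣ ⟩
      ∣ A ∣                 ≡⟨ ∣p∣≡∣p∩q∣+∣p─q∣ A e ⟩
      ∣ A ∩ e ∣ + ∣ A ─ e ∣ ≡⟨ +-comm ∣ A ∩ e ∣ ∣ A ─ e ∣ ⟩
      ∣ A ─ e ∣ + ∣ A ∩ e ∣ ∎)
      where open ≤-Reasoning

  dependent⇒⊇circuit : ∀ {A} → Dependent A → ∃ λ C → Circuit C × C ⊆ A
  dependent⇒⊇circuit dep =
    let Z , Z⊆A , dep-Z , Z-min = ⊆-minimal dependent? dep
        S , gen-S , S⊆Z = dependent⇒⊇generator dep-Z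
        S-min T gen-T T⊂S = Z-min T (generator⇒dependent gen-T) (⊂-⊆-trans T⊂S S⊆Z)
    in S , (gen-S , S-min) , ⊆-trans S⊆Z Z⊆A

  ⊂circuit⇒independent : ∀ {X B} → Circuit X → B ⊂ X → ¬ Dependent B
  ⊂circuit⇒independent (_ , X-min) B⊂X dep =
    let S , gen-S , S⊆B = dependent⇒⊇generator dep
    in X-min S gen-S (⊆-⊂-trans S⊆B B⊂X)

  circuit-⊈ : ∀ {X Y} → Circuit X → Circuit Y → X ≢ Y → ¬ X ⊆ Y
  circuit-⊈ cX cY X≢Y X⊆Y = X≢Y (Minimal-⊆⇒≡ cX cY X⊆Y)

  large⊂⇒dependent : ∀ {Z U} x → ∣ Z ∣ ≡ suc n → Z ⊂ U → Dependent (U - x)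
  large⊂⇒dependent {Z} {U} x ∣Z∣≡1+n Z⊂U = n<∣A∣⇒dependent (U - x) (s≤s⁻¹ (begin-strict
    suc n         ≡⟨ ∣Z∣≡1+n ⟨
    ∣ Z ∣         <⟨ p⊂q⇒∣p∣<∣q∣ Z⊂U ⟩
    ∣ U ∣         ≤⟨ ∣p∣≤1+∣p-x∣ U x ⟩
    suc ∣ U - x ∣ ∎))
    where open ≤-Reasoning

  typed∪-dependent : CrossingInequality → ∀ {X Y i j e₁ e₂} x →
    (i , e₁) ∈ Δ → X ⊆ e₁ → ∣ X ∣ ≡ suc (toℕ i) →
    (j , e₂) ∈ Δ → Y ⊆ e₂ → ∣ Y ∣ ≡ suc (toℕ j) →
    ∣ X ∩ Y ∣ ≤ valuation Δ (X ∩ Y) → Dependent ((X ∪ Y) - x)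
  typed∪-dependent crossing {X} {Y} {i} {j} {e₁} {e₂} x
    i∈Δ X⊆e₁ ∣X∣≡1+i j∈Δ Y⊆e₂ ∣Y∣≡1+j ∣I∣≤vI = +-cancelʳ-< ∣ X ∩ Y ∣ _ _ (begin-strict
      valuation Δ ((X ∪ Y) - x) + ∣ X ∩ Y ∣         ≤⟨ +-mono-≤ v[U-x]≤v[e₁∪e₂] ∣I∣≤v[e₁∩e₂] ⟩
      valuation Δ (e₁ ∪ e₂) + valuation Δ (e₁ ∩ e₂) ≡⟨ +-comm (valuation Δ (e₁ ∪ e₂)) _ ⟩
      valuation Δ (e₁ ∩ e₂) + valuation Δ (e₁ ∪ e₂) ≤⟨ crossing i j e₁ e₂ i∈Δ j∈Δ ⟩
      toℕ i + toℕ j                                 <⟨ +-monoʳ-< (toℕ i) (n<1+n (toℕ j)) ⟩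
      toℕ i + suc (toℕ j)                           ≤⟨ s≤s⁻¹ sizes ⟩
      ∣ (X ∪ Y) - x ∣ + ∣ X ∩ Y ∣                   ∎)
    where
    open ≤-Reasoning
    v[U-x]≤v[e₁∪e₂] : valuation Δ ((X ∪ Y) - x) ≤ valuation Δ (e₁ ∪ e₂)
    v[U-x]≤v[e₁∪e₂] = valuation-mono-⊆ Δ (⊆-trans (p─q⊆p (X ∪ Y) ⁅ x ⁆) (∪-mono-⊆ X⊆e₁ Y⊆e₂))
    ∣I∣≤v[e₁∩e₂] : ∣ X ∩ Y ∣ ≤ valuation Δ (e₁ ∩ e₂)
    ∣I∣≤v[e₁∩e₂] = ≤-trans ∣I∣≤vI (valuation-mono-⊆ Δ (∩-mono-⊆ X⊆e₁ Y⊆e₂))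
    sizes : suc (toℕ i) + suc (toℕ j) ≤ suc (∣ (X ∪ Y) - x ∣ + ∣ X ∩ Y ∣)
    sizes = begin
      suc (toℕ i) + suc (toℕ j)     ≡⟨ cong₂ _+_ ∣X∣≡1+i ∣Y∣≡1+j ⟨
      ∣ X ∣ + ∣ Y ∣                 ≡⟨ ∣p∪q∣+∣p∩q∣≡∣p∣+∣q∣ X Y ⟨
      ∣ X ∪ Y ∣ + ∣ X ∩ Y ∣         ≤⟨ +-monoˡ-≤ ∣ X ∩ Y ∣ (∣p∣≤1+∣p-x∣ (X ∪ Y) x) ⟩
      suc ∣ (X ∪ Y) - x ∣ + ∣ X ∩ Y ∣ ∎

  circuits∪-dependent : CrossingInequality → ∀ {X Y} → Circuit X → Circuit Y → X ≢ Y →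
                        ∀ x → Dependent ((X ∪ Y) - x)
  circuits∪-dependent _ cX@(inj₂ ∣X∣≡1+n , _) cY X≢Y x =
    large⊂⇒dependent x ∣X∣≡1+n (q⊈p⇒p⊂p∪q (circuit-⊈ cY cX (X≢Y ∘ sym)))
  circuits∪-dependent _ {X} {Y} cX@(inj₁ _ , _) cY@(inj₂ ∣Y∣≡1+n , _) X≢Y x =
    large⊂⇒dependent x ∣Y∣≡1+n (subst (Y ⊂_) (∪-comm Y X) (q⊈p⇒p⊂p∪q (circuit-⊈ cX cY X≢Y)))
  circuits∪-dependent crossing
    cX@(inj₁ (_ , _ , i∈Δ , X⊆e₁ , ∣X∣≡1+i) , _)
    cY@(inj₁ (_ , _ , j∈Δ , Y⊆e₂ , ∣Y∣≡1+j) , _) X≢Y x =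
    typed∪-dependent crossing x i∈Δ X⊆e₁ ∣X∣≡1+i j∈Δ Y⊆e₂ ∣Y∣≡1+j
      (≮⇒≥ (⊂circuit⇒independent cX (p⊈q⇒p∩q⊂p (circuit-⊈ cX cY X≢Y))))

lemma4p4 : (n d : ℕ) (Δ : LabeledEdges n d) → IsLabeledHypergraph n d Δ →
    (∀ (i j : Fin n) (e₁ e₂ : Subset d) → (i , e₁) ∈ Δ → (j , e₂) ∈ Δ →
      valuation Δ (e₁ ∩ e₂) + valuation Δ (e₁ ∪ e₂) ≤ toℕ i + toℕ j) →
    IsMatroidCircuits d (InMinGenerators Δ)
lemma4p4 n d Δ _ crossing = record
  { C1 = λ c⊥ → ⊥-independent Δ (generator⇒dependent Δ (proj₁ c⊥))
  ; C2 = λ _ _ → Minimal-⊆⇒≡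
  ; C3 = λ X Y x cX cY X≢Y _ → dependent⇒⊇circuit Δ (circuits∪-dependent Δ crossing cX cY X≢Y x)
  }
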